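{- For every sufficiently small $\varepsilon>0$ there exist an instance of the hereditary maximin share problem (agents, items, a hereditary set system and nonnegative item values, as in the context) with ${\tt MMS}(i)=1$ for every agent $i$, a choice of maximin partitions, and a valid execution of the Fair Division Procedure with target value $\alpha=\frac{40}{107}+\varepsilon$ in which at least one agent is not allocated any bundle. In this sense the performance guarantee of the procedure is at most $\frac{40}{107}$.
   Context: A hereditary set system $H=(J,\mathcal{F})$ consists of a finite set $J$ of items and a nonempty family $\mathcal{F}$ of subsets of $J$ such that $S\in\mathcal{F}$ and $T\subseteq S$ imply $T\in\mathcal{F}$. There is a set $I$ of $n$ agents; agent $i$ has a nonnegative value $v_{i,j}$ for each item $j$, and $v_i(S)=\max_{T\in\mathcal{F},\,T\subseteq S}\sum_{j\in T}v_{i,j}$ for $S\subseteq J$. The maximin share ${\tt MMS}(i)$ is the maximum, over partitions of $J$ into $n$ parts, of the minimum value $v_i$ of a part; a partition attaining it is a maximin partition for $i$. Fair Division Procedure with target $\alpha$: (1) for each agent $i$ fix a maximin partition $\mathcal{P}_i$; for an item $j$ in part $P\in\mathcal{P}_i$ set $\hat v_{i,j}=v_{i,j}/v_i(P)$ and $\hat v_i(S)=\max_{T\in\mathcal{F},T\subseteq S}\sum_{j\in T}\hat v_{i,j}$. (2) Let $I$ be all agents and $J$ all items; for $\tau=1,\dots,|J|$: while there exist $S\subseteq J$ with $|S|=\tau$ and $i\in I$ with $\hat v_i(S)\ge\alpha$, choose any such pair, allocate $S$ to $i$, and set $I\leftarrow I\setminus\{i\}$, $J\leftarrow J\setminus S$.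 A valid execution is any run of this procedure for some choice of the pairs $(S,i)$.
   Formalization: The parameter ε ranges over the rationals, and the item values $v_{i,j}$ of the constructed instance are taken in the rationals. -}

module Defs where

open import Data.Bool using (Bool; true; false; if_then_else_; _∧_)
open import Data.Nat as ℕ using (ℕ; zero; suc)
open import Data.Fin using (Fin; zero; suc; _≟_)
open import Data.Fin.Subset using (Subset; _∈_; _⊆_; ⊤; ⊥; ∣_∣; _─_; ⁅_⁆)
open import Data.Fin.Subset.Properties using (_⊆?_)
open import Data.Vec using (Vec; []; _∷_; tabulate)
open import Data.List using (List; []; _∷_; map; _++_; foldr; filterᵇ)
open import Data.Rational using (ℚ; 0ℚ; _+_; _÷_; _⊔_; _≤_; _<_; ≢-nonZero)
import Data.Rational.Properties as ℚP
open import Data.Product using (Σ; ∃; ∃-syntax; _×_; _,_)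
open import Relation.Nullary using (yes; no; ¬_)
open import Relation.Nullary.Decidable using (⌊_⌋)
open import Relation.Binary.PropositionalEquality using (_≡_)

allSubsets : (m : ℕ) → List (Subset m)
allSubsets zero = [] ∷ []
allSubsets (suc m) = map (true ∷_) (allSubsets m) ++ map (false ∷_) (allSubsets m)

sumSub : {m : ℕ} → (Fin m → ℚ) → Subset m → ℚ
sumSub {zero} w [] = 0ℚ
sumSub {suc m} w (b ∷ T) = (if b then w zero else 0ℚ) + sumSub (λ j → w (suc j)) T

-- total division (the second branch is never used below, since the
-- denominators are values of parts of maximin partitions, which are ≥ 1)
safeDiv : ℚ → ℚ → ℚ
safeDiv p q with q Data.Rational.≟ 0ℚ
... | yes _ = 0ℚ
... | no q≢0 = _÷_ p q {{≢-nonZero q≢0}}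

record Instance : Set where
  field
    n : ℕ
    m : ℕ
    F : Subset m → Bool
    F-nonempty : ∃[ S ] (F S ≡ true)
    F-hereditary : ∀ (S T : Subset m) → T ⊆ S → F S ≡ true → F T ≡ true
    v : Fin n → Fin m → ℚ
    v-nonneg : ∀ i j → 0ℚ ≤ v i j

module _ (H : Instance) where
  open Instance H

  valW : (Fin m → ℚ) → Subset m → ℚ
  valW w S = foldr _⊔_ 0ℚ
    (map (sumSub w) (filterᵇ (λ T → F T ∧ ⌊ T ⊆? S ⌋) (allSubsets m)))

  val : Fin n → Subset m → ℚ
  val i S = valW (v i) S

  Partition : Set
  Partition = Fin m → Fin n

  part : Partition → Fin n → Subset m
  part p k = tabulate (λ j → ⌊ p j ≟ k ⌋)

  MinPart : Fin n → Partition → ℚ → Set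
  MinPart i p x = (∀ k → x ≤ val i (part p k)) × (∃[ k ] (val i (part p k) ≡ x))

  IsMMS : Fin n → ℚ → Set
  IsMMS i x = (∃[ p ] MinPart i p x) × (∀ p y → MinPart i p y → y ≤ x)

  IsMaximinPartition : Fin n → Partition → Set
  IsMaximinPartition i p = ∃[ x ] (IsMMS i x × MinPart i p x)

  module Procedure (P : Fin n → Partition) (α : ℚ) where

    vhat : Fin n → Fin m → ℚ
    vhat i j = safeDiv (v i j) (val i (part (P i) (P i j)))

    valhat : Fin n → Subset m → ℚ
    valhat i S = valW (vhat i) S

    -- Exec τ I J I' : a valid run of step (2), started at phase τ with
    -- remaining agents I and remaining items J, ends with remaining agents I'.
    data Exec : ℕ → Subset n → Subset m → Subset n → Set where
      finish : ∀ {τ I J} → m ℕ.< τ → Exec τ I J I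
      alloc  : ∀ {τ I J I'} (i : Fin n) (S : Subset m) →
               i ∈ I → S ⊆ J → ∣ S ∣ ≡ τ → α ≤ valhat i S →
               Exec τ (I ─ ⁅ i ⁆) (J ─ S) I' → Exec τ I J I'
      next   : ∀ {τ I J I'} → τ ℕ.≤ m →
               (∀ (i : Fin n) (S : Subset m) → i ∈ I → S ⊆ J → ∣ S ∣ ≡ τ →
                  valhat i S < α) →
               Exec (suc τ) I J I' → Exec τ I J I'

    SomeAgentUnallocated : Set
    SomeAgentUnallocated = ∃[ I' ] (Exec 1 ⊤ ⊤ I' × ∃[ i ] (i ∈ I'))

-- Take 78 agents with identical valuations and 858 items forming 78 rows of 11 items.
-- In units of 1/107 a row has one item of value 40, one of value 19, 21 or 20 and one of value
-- 8, 6 or 7 (in 36, 18 and 24 rows respectively), and eight items of value 5, so every row is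
-- worth exactly 1. The feasible sets are the subsets of the rows and of 77 bundles: 39 pairs of
-- 40s, 18 triples {19, 19, 21}, 8 triples {20, 20, 20}, 6 sets of six 8s and 6 sets
-- {6, 6, 6, 7, 7, 7, 7}. The rows form a maximin partition, and MMS = 1 because the total value
-- is 78, so every partition has a part worth at most 1. Every bundle is worth at least 46, which
-- exceeds α as long as ε < 6/107, so the procedure may hand the bundles to 77 agents in the
-- phases τ = 2, 3, 6, 7, while in every phase no feasible set of τ remaining items is worth more
-- than 40 < α. Afterwards only the 5s are left, and the eight 5s of a row are worth 40 < α: the
-- last agent receives nothing.

module Submission where

module SubsetSums where

  open import Algebra.Properties.CommutativeSemigroup using (x∙yz≈y∙xz)
  open import Data.Bool using (Bool; true; false; if_then_else_; _∨_; T)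
  open import Data.Bool.Properties using (T-∨)
  open import Data.Fin.Subset using (Subset; _⊆_; ∣_∣)
  open import Data.Fin.Subset.Properties using (drop-∷-⊆; p⊆q⇒∣p∣≤∣q∣)
  open import Data.Nat using (ℕ; suc; _+_; _*_; _∸_; _≤_; _⊔_; _⊓_; _≤ᵇ_; z≤n)
  open import Data.Nat.Properties
  open import Data.Product using (_×_; _,_)
  open import Data.Sum using (inj₁; inj₂)
  open import Data.Unit using (⊤; tt)
  open import Data.Vec using ([]; _∷_; here)
  open import Function.Bundles using (Equivalence)
  open import Relation.Binary.PropositionalEquality

  -- sumFrom f o p = Σ_{j ∈ p} f (o + j); the offset keeps evaluation on concrete vectors linear
  sumFrom : ∀ {l} → (ℕ → ℕ) → ℕ → Subset l → ℕ
  sumFrom f o []      = 0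
  sumFrom f o (b ∷ p) = (if b then f o else 0) + sumFrom f (suc o) p

  maxFrom : ∀ {l} → (ℕ → ℕ) → ℕ → Subset l → ℕ
  maxFrom f o []      = 0
  maxFrom f o (b ∷ p) = (if b then f o else 0) ⊔ maxFrom f (suc o) p

  -- c is only the value for the empty set
  minFromOr : ∀ {l} → ℕ → (ℕ → ℕ) → ℕ → Subset l → ℕ
  minFromOr c f o []          = c
  minFromOr c f o (true ∷ p)  = f o ⊓ minFromOr c f (suc o) p
  minFromOr c f o (false ∷ p) = minFromOr c f (suc o) p

  AllAtLeast : ∀ {l} → ℕ → (ℕ → ℕ) → ℕ → Subset l → Set
  AllAtLeast c f o []      = ⊤
  AllAtLeast c f o (b ∷ p) = (T b → c ≤ f o) × AllAtLeast c f (suc o) p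

  AllAtLeast-anti : ∀ {l c d} f o (p : Subset l) → d ≤ c → AllAtLeast c f o p → AllAtLeast d f o p
  AllAtLeast-anti f o []      d≤c _         = tt
  AllAtLeast-anti f o (b ∷ p) d≤c (hd , tl) = (λ b → ≤-trans d≤c (hd b)) , AllAtLeast-anti f (suc o) p d≤c tl

  AllAtLeast-minFromOr : ∀ {l} c f o (p : Subset l) → AllAtLeast (minFromOr c f o p) f o p
  AllAtLeast-minFromOr c f o []          = tt
  AllAtLeast-minFromOr c f o (true ∷ p)  =
    (λ _ → m⊓n≤m (f o) _) , AllAtLeast-anti f (suc o) p (m⊓n≤n (f o) _) (AllAtLeast-minFromOr c f (suc o) p)
  AllAtLeast-minFromOr c f o (false ∷ p) = (λ ()) , AllAtLeast-minFromOr c f (suc o) p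

  module _ (f : ℕ → ℕ) where

    sumFrom-mono : ∀ {l} o {p q : Subset l} → p ⊆ q → sumFrom f o p ≤ sumFrom f o q
    sumFrom-mono o {[]}        {[]}        _   = z≤n
    sumFrom-mono o {true ∷ p}  {true ∷ q}  p⊆q = +-monoʳ-≤ (f o) (sumFrom-mono (suc o) (drop-∷-⊆ p⊆q))
    sumFrom-mono o {true ∷ p}  {false ∷ q} p⊆q with p⊆q here
    ... | ()
    sumFrom-mono o {false ∷ p} {true ∷ q}  p⊆q = ≤-trans (sumFrom-mono (suc o) (drop-∷-⊆ p⊆q)) (m≤n+m _ (f o))
    sumFrom-mono o {false ∷ p} {false ∷ q} p⊆q = sumFrom-mono (suc o) (drop-∷-⊆ p⊆q)

    sumFrom≤∣∣*maxFrom : ∀ {l} o {p q : Subset l} → p ⊆ q → sumFrom f o p ≤ ∣ p ∣ * maxFrom f o q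
    sumFrom≤∣∣*maxFrom o {[]}        {[]}        _   = z≤n
    sumFrom≤∣∣*maxFrom o {true ∷ p}  {true ∷ q}  p⊆q =
      +-mono-≤ (m≤m⊔n (f o) _)
        (≤-trans (sumFrom≤∣∣*maxFrom (suc o) (drop-∷-⊆ p⊆q)) (*-monoʳ-≤ ∣ p ∣ (m≤n⊔m (f o) _)))
    sumFrom≤∣∣*maxFrom o {true ∷ p}  {false ∷ q} p⊆q with p⊆q here
    ... | ()
    sumFrom≤∣∣*maxFrom o {false ∷ p} {b ∷ q}     p⊆q =
      ≤-trans (sumFrom≤∣∣*maxFrom (suc o) (drop-∷-⊆ p⊆q)) (*-monoʳ-≤ ∣ p ∣ (m≤n⊔m _ _))

    sumFrom-+-missing : ∀ {l} c o {p q : Subset l} → AllAtLeast c f o q → p ⊆ q →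
                        sumFrom f o p + (∣ q ∣ ∸ ∣ p ∣) * c ≤ sumFrom f o q
    sumFrom-+-missing c o {[]}        {[]}        _         _   = z≤n
    sumFrom-+-missing c o {true ∷ p}  {true ∷ q}  (_ , tl)  p⊆q = begin
      f o + sumFrom f (suc o) p + (∣ q ∣ ∸ ∣ p ∣) * c   ≡⟨ +-assoc (f o) _ _ ⟩
      f o + (sumFrom f (suc o) p + (∣ q ∣ ∸ ∣ p ∣) * c) ≤⟨ +-monoʳ-≤ (f o) (sumFrom-+-missing c (suc o) tl (drop-∷-⊆ p⊆q)) ⟩
      f o + sumFrom f (suc o) q                          ∎
      where open ≤-Reasoning
    sumFrom-+-missing c o {true ∷ p}  {false ∷ q} _         p⊆q with p⊆q here
    ... | ()
    sumFrom-+-missing c o {false ∷ p} {true ∷ q}  (hd , tl) p⊆q = begin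
      sumFrom f (suc o) p + (suc ∣ q ∣ ∸ ∣ p ∣) * c     ≡⟨ cong (λ k → sumFrom f (suc o) p + k * c) (+-∸-assoc 1 ∣p∣≤∣q∣) ⟩
      sumFrom f (suc o) p + (c + (∣ q ∣ ∸ ∣ p ∣) * c)   ≡⟨ x∙yz≈y∙xz +-commutativeSemigroup (sumFrom f (suc o) p) c _ ⟩
      c + (sumFrom f (suc o) p + (∣ q ∣ ∸ ∣ p ∣) * c)   ≤⟨ +-mono-≤ (hd tt) (sumFrom-+-missing c (suc o) tl (drop-∷-⊆ p⊆q)) ⟩
      f o + sumFrom f (suc o) q                          ∎
      where
      open ≤-Reasoning
      ∣p∣≤∣q∣ = p⊆q⇒∣p∣≤∣q∣ (drop-∷-⊆ p⊆q)
    sumFrom-+-missing c o {false ∷ p} {false ∷ q} (_ , tl)  p⊆q = sumFrom-+-missing c (suc o) tl (drop-∷-⊆ p⊆q)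

  -- A test that every subset of q with at most s elements has sum at most B: either s copies of
  -- the maximum fit into B, or dropping the ∣ q ∣ ∸ s smallest elements already brings q below B.
  subsetSumsAtMost : ∀ {l} → ℕ → (ℕ → ℕ) → ℕ → Subset l → Bool
  subsetSumsAtMost s f B q =
    (s * maxFrom f 0 q ≤ᵇ B) ∨ (sumFrom f 0 q ≤ᵇ B + (∣ q ∣ ∸ s) * minFromOr B f 0 q)

  subsetSumsAtMost-sound : ∀ {l} s f B {p q : Subset l} → T (subsetSumsAtMost s f B q) →
                           p ⊆ q → ∣ p ∣ ≤ s → sumFrom f 0 p ≤ B
  subsetSumsAtMost-sound s f B {p} {q} test p⊆q ∣p∣≤s with Equivalence.to T-∨ test
  ... | inj₁ max-small = begin
    sumFrom f 0 p          ≤⟨ sumFrom≤∣∣*maxFrom f 0 p⊆q ⟩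
    ∣ p ∣ * maxFrom f 0 q  ≤⟨ *-monoˡ-≤ (maxFrom f 0 q) ∣p∣≤s ⟩
    s * maxFrom f 0 q      ≤⟨ ≤ᵇ⇒≤ _ _ max-small ⟩
    B                      ∎
    where open ≤-Reasoning
  ... | inj₂ rest-heavy = +-cancelʳ-≤ ((∣ q ∣ ∸ s) * minFromOr B f 0 q) (sumFrom f 0 p) B (begin
    sumFrom f 0 p + (∣ q ∣ ∸ s) * minFromOr B f 0 q
      ≤⟨ +-monoʳ-≤ (sumFrom f 0 p) (*-monoˡ-≤ (minFromOr B f 0 q) (∸-monoʳ-≤ ∣ q ∣ ∣p∣≤s)) ⟩
    sumFrom f 0 p + (∣ q ∣ ∸ ∣ p ∣) * minFromOr B f 0 q
      ≤⟨ sumFrom-+-missing f _ 0 (AllAtLeast-minFromOr B f 0 q) p⊆q ⟩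
    sumFrom f 0 q
      ≤⟨ ≤ᵇ⇒≤ _ _ rest-heavy ⟩
    B + (∣ q ∣ ∸ s) * minFromOr B f 0 q ∎)
    where open ≤-Reasoning

module ScaledRationals where

  open SubsetSums using (sumFrom)
  open import Defs using (sumSub)
  open import Data.Bool using (true; false; if_then_else_)
  open import Data.Fin using (Fin; zero; suc; toℕ)
  open import Data.Integer as ℤ using (+_; +≤+)
  import Data.Integer.Properties as ℤ
  open import Data.Integer.Tactic.RingSolver using (solve-∀)
  open import Data.Nat as ℕ using (ℕ; suc; NonZero)
  import Data.Nat.Properties as ℕ
  open import Data.Rational using (ℚ; 0ℚ; _+_; _/_; _≤_; toℚᵘ; fromℚᵘ)
  open import Data.Rational.Properties
  open import Data.Rational.Unnormalised as ℚᵘ using (mkℚᵘ; *≡*; *≤*)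
  import Data.Rational.Unnormalised.Properties as ℚᵘ
  open import Data.Vec using ([]; _∷_)
  open import Relation.Binary.PropositionalEquality

  /-homo-+ : ∀ a b d .{{_ : NonZero d}} → + (a ℕ.+ b) / d ≡ + a / d + + b / d
  /-homo-+ a b (suc d) = begin
    fromℚᵘ (u (a ℕ.+ b))
      ≡⟨ fromℚᵘ-cong (ℚᵘ.≃-trans u-homo-+ (ℚᵘ.+-cong (ℚᵘ.≃-sym (toℚᵘ-fromℚᵘ (u a))) (ℚᵘ.≃-sym (toℚᵘ-fromℚᵘ (u b))))) ⟩
    fromℚᵘ (toℚᵘ (fromℚᵘ (u a)) ℚᵘ.+ toℚᵘ (fromℚᵘ (u b)))
      ≡⟨ fromℚᵘ-cong (toℚᵘ-homo-+ (fromℚᵘ (u a)) (fromℚᵘ (u b))) ⟨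
    fromℚᵘ (toℚᵘ (fromℚᵘ (u a) + fromℚᵘ (u b)))
      ≡⟨ fromℚᵘ-toℚᵘ _ ⟩
    fromℚᵘ (u a) + fromℚᵘ (u b) ∎
    where
    open ≡-Reasoning
    u : ℕ → ℚᵘ.ℚᵘ
    u n = mkℚᵘ (+ n) d
    cross-multiplied : ∀ x y z → (x ℤ.+ y) ℤ.* (z ℤ.* z) ≡ (x ℤ.* z ℤ.+ y ℤ.* z) ℤ.* z
    cross-multiplied = solve-∀
    u-homo-+ : u (a ℕ.+ b) ℚᵘ.≃ u a ℚᵘ.+ u b
    u-homo-+ = *≡* (trans (cong (ℤ._* (+ suc d ℤ.* + suc d)) (ℤ.pos-+ a b)) (cross-multiplied (+ a) (+ b) (+ suc d)))

  /-monoˡ-≤ : ∀ {a b} d .{{_ : NonZero d}} → a ℕ.≤ b → + a / d ≤ + b / d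
  /-monoˡ-≤ {a} {b} (suc d) a≤b = toℚᵘ-cancel-≤
    (ℚᵘ.≤-respˡ-≃ (ℚᵘ.≃-sym (toℚᵘ-fromℚᵘ (mkℚᵘ (+ a) d)))
    (ℚᵘ.≤-respʳ-≃ (ℚᵘ.≃-sym (toℚᵘ-fromℚᵘ (mkℚᵘ (+ b) d)))
    (*≤* (ℤ.*-monoʳ-≤-nonNeg (+ suc d) (+≤+ a≤b)))))

  +/-nonNeg : ∀ a d .{{_ : NonZero d}} → 0ℚ ≤ + a / d
  +/-nonNeg a d = nonNegative⁻¹ (+ a / d) {{normalize-nonNeg a d}}

  sumSub-/ : ∀ {l} (f : ℕ → ℕ) o d .{{_ : NonZero d}} (w : Fin l → ℚ) →
             (∀ j → w j ≡ + f (o ℕ.+ toℕ j) / d) → ∀ T → sumSub w T ≡ + sumFrom f o T / d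
  sumSub-/ f o d w w≡ []      = sym (0/n≡0 d)
  sumSub-/ f o d w w≡ (b ∷ T) = begin
    (if b then w zero else 0ℚ) + sumSub (λ j → w (suc j)) T
      ≡⟨ cong₂ _+_ (head b) (sumSub-/ f (suc o) d (λ j → w (suc j)) w∘suc≡ T) ⟩
    + (if b then f o else 0) / d + + sumFrom f (suc o) T / d
      ≡⟨ /-homo-+ (if b then f o else 0) _ d ⟨
    + ((if b then f o else 0) ℕ.+ sumFrom f (suc o) T) / d ∎
    where
    open ≡-Reasoning
    head : ∀ b → (if b then w zero else 0ℚ) ≡ + (if b then f o else 0) / d
    head true  = trans (w≡ zero) (cong (λ k → + f k / d) (ℕ.+-identityʳ o))
    head false = sym (0/n≡0 d)
    w∘suc≡ : ∀ j → w (suc j) ≡ + f (suc o ℕ.+ toℕ j) / d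
    w∘suc≡ j = trans (w≡ (suc j)) (cong (λ k → + f k / d) (ℕ.+-suc o (toℕ j)))

module Classes where

  open SubsetSums using (sumFrom)
  open import Data.Bool using (Bool; if_then_else_)
  open import Data.Fin using (Fin; zero; suc; toℕ; _≟_)
  open import Data.Fin.Properties using (toℕ-injective)
  open import Data.Fin.Subset using (Subset; ⊤)
  open import Data.Nat as ℕ using (ℕ; zero; suc; _+_; _*_; _≤_; _<_; _≤?_; _≡ᵇ_)
  import Data.Nat.Properties as ℕ
  open import Algebra.Properties.CommutativeMonoid.Sum ℕ.+-0-commutativeMonoid
    using (sum-syntax; ∑-distrib-+; sum-replicate-zero; sum-cong-≗)
  open import Data.Product using (_,_; ∃-syntax)
  open import Data.Vec using ([]; _∷_; tabulate)
  open import Data.Vec.Properties using (tabulate-cong)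
  open import Function using (_∘_; mk⇔)
  open import Relation.Nullary using (yes; no)
  open import Relation.Nullary.Decidable using (⌊_⌋; ⌊⌋-map′; isYes≗does; does-⇔)
  open import Relation.Binary.PropositionalEquality

  class : ∀ {l k} → (Fin l → Fin k) → Fin k → Subset l
  class p c = tabulate (λ j → ⌊ p j ≟ c ⌋)

  ∑-indicator : ∀ {k} (x : Fin k) a → ∑[ c < k ] (if ⌊ x ≟ c ⌋ then a else 0) ≡ a
  ∑-indicator {suc k} zero    a = trans (cong (a +_) (sum-replicate-zero k)) (ℕ.+-identityʳ a)
  ∑-indicator {suc k} (suc x) a =
    trans (sum-cong-≗ (λ c → cong (if_then a else 0) (⌊⌋-map′ _ _ (x ≟ c)))) (∑-indicator x a)

  ∑-sumFrom-class : ∀ {l k} (p : Fin l → Fin k) f o → ∑[ c < k ] sumFrom f o (class p c) ≡ sumFrom f o (⊤ {l})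
  ∑-sumFrom-class {zero}  {k} p f o = sum-replicate-zero k
  ∑-sumFrom-class {suc l} {k} p f o = begin
    ∑[ c < k ] (first c + sumFrom f (suc o) (class (p ∘ suc) c))
      ≡⟨ ∑-distrib-+ first (λ c → sumFrom f (suc o) (class (p ∘ suc) c)) ⟩
    ∑[ c < k ] first c + ∑[ c < k ] sumFrom f (suc o) (class (p ∘ suc) c)
      ≡⟨ cong₂ _+_ (∑-indicator (p zero) (f o)) (∑-sumFrom-class (p ∘ suc) f (suc o)) ⟩
    f o + sumFrom f (suc o) (⊤ {l}) ∎
    where
    open ≡-Reasoning
    first : Fin k → ℕ
    first c = if ⌊ p zero ≟ c ⌋ then f o else 0

  ∑<*⇒∃≤ : ∀ {k} c (g : Fin k → ℕ) → ∑[ x < k ] g x < k * suc c → ∃[ x ] g x ≤ c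
  ∑<*⇒∃≤ {zero}  c g ()
  ∑<*⇒∃≤ {suc k} c g ∑g< with g zero ≤? c
  ... | yes g₀≤c = zero , g₀≤c
  ... | no g₀≰c with ∑<*⇒∃≤ c (g ∘ suc) (ℕ.+-cancelˡ-< (suc c) _ _ (ℕ.≤-<-trans (ℕ.+-monoˡ-≤ _ (ℕ.≰⇒> g₀≰c)) ∑g<))
  ...   | x , gx≤c = suc x , gx≤c

  indicatorFrom : ∀ l → ℕ → (ℕ → Bool) → Subset l
  indicatorFrom zero    o g = []
  indicatorFrom (suc l) o g = g o ∷ indicatorFrom l (suc o) g

  indicatorFrom≡tabulate : ∀ l o g → indicatorFrom l o g ≡ tabulate (λ j → g (o + toℕ j))
  indicatorFrom≡tabulate zero    o g = refl
  indicatorFrom≡tabulate (suc l) o g = cong₂ _∷_ (cong g (sym (ℕ.+-identityʳ o)))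
    (trans (indicatorFrom≡tabulate l (suc o) g) (tabulate-cong (λ j → cong g (sym (ℕ.+-suc o (toℕ j))))))

  ⌊≟⌋≡toℕ≡ᵇtoℕ : ∀ {k} (x y : Fin k) → ⌊ x ≟ y ⌋ ≡ (toℕ x ≡ᵇ toℕ y)
  ⌊≟⌋≡toℕ≡ᵇtoℕ x y =
    trans (isYes≗does (x ≟ y)) (does-⇔ (mk⇔ (cong toℕ) toℕ-injective) (x ≟ y) (toℕ x ℕ.≟ toℕ y))

  class≡indicatorFrom : ∀ {l k} (p : Fin l → Fin k) (g : ℕ → ℕ) → (∀ j → toℕ (p j) ≡ g (toℕ j)) →
                        ∀ c → class p c ≡ indicatorFrom l 0 (λ x → g x ≡ᵇ toℕ c)
  class≡indicatorFrom {l} p g p≡g c = trans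
    (tabulate-cong (λ j → trans (⌊≟⌋≡toℕ≡ᵇtoℕ (p j) c) (cong (_≡ᵇ toℕ c) (p≡g j))))
    (sym (indicatorFrom≡tabulate l 0 (λ x → g x ≡ᵇ toℕ c)))

module HereditaryValues where

  open import Defs
  open import Data.Bool using (Bool; true; false; if_then_else_; _∧_; T)
  open import Data.Bool.Properties using (T?; T-∧; T-≡)
  open import Data.Fin using (Fin)
  open import Data.Fin.Subset using (Subset; _⊆_; _─_; ⁅_⁆; ∣_∣) renaming (_∈_ to _∈ₛ_)
  open import Data.Fin.Subset.Properties using (_⊆?_; _∈?_; ⊆-trans)
  open import Data.List using (List; []; _∷_; map; foldr; filterᵇ)
  open import Data.List.Membership.Propositional using (_∈_)
  open import Data.List.Membership.Propositional.Properties using (∈-++⁺ˡ; ∈-++⁺ʳ; ∈-map⁺; ∈-filter⁺; ∈-filter⁻)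
  open import Data.List.Properties using (map-cong)
  open import Data.List.Relation.Unary.All using (All; []; _∷_)
  open import Data.List.Relation.Unary.Any as Any using (Any; here; there; any?)
  open import Data.Nat as ℕ using (ℕ; zero; suc)
  import Data.Nat.Properties as ℕ
  open import Data.Product using (_×_; _,_; proj₁; proj₂; ∃-syntax)
  open import Data.Rational using (ℚ; 0ℚ; 1ℚ; _+_; _⊔_; _≤_; _<_)
  open import Data.Rational.Properties using (≤-trans; ≤-reflexive; p≤p⊔q; p≤q⊔p; ⊔-lub; *-identityʳ)
  open import Data.Vec using ([]; _∷_)
  open import Function using (_∘_)
  open import Function.Bundles using (Equivalence)
  open import Relation.Nullary using (yes; no)
  open import Relation.Nullary.Decidable using (⌊_⌋; toWitness; fromWitness)
  open import Relation.Binary.PropositionalEquality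

  ∈-allSubsets : ∀ {k} (T : Subset k) → T ∈ allSubsets k
  ∈-allSubsets []          = here refl
  ∈-allSubsets (true ∷ T)  = ∈-++⁺ˡ (∈-map⁺ (true ∷_) (∈-allSubsets T))
  ∈-allSubsets (false ∷ T) = ∈-++⁺ʳ _ (∈-map⁺ (false ∷_) (∈-allSubsets T))

  module _ {A : Set} (g : A → ℚ) where

    foldr-⊔-upper : ∀ {x} xs → x ∈ xs → g x ≤ foldr _⊔_ 0ℚ (map g xs)
    foldr-⊔-upper (y ∷ xs) (here refl)  = p≤p⊔q (g y) _
    foldr-⊔-upper (y ∷ xs) (there x∈xs) = ≤-trans (foldr-⊔-upper xs x∈xs) (p≤q⊔p (g y) _)

    foldr-⊔-least : ∀ {c} xs → 0ℚ ≤ c → (∀ x → x ∈ xs → g x ≤ c) → foldr _⊔_ 0ℚ (map g xs) ≤ c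
    foldr-⊔-least []       0≤c _     = 0≤c
    foldr-⊔-least (y ∷ xs) 0≤c bound =
      ⊔-lub (bound y (here refl)) (foldr-⊔-least xs 0≤c (λ x x∈xs → bound x (there x∈xs)))

  sumSub-cong : ∀ {k} {w w′ : Fin k → ℚ} → (∀ j → w j ≡ w′ j) → ∀ T → sumSub w T ≡ sumSub w′ T
  sumSub-cong w≡w′ []      = refl
  sumSub-cong w≡w′ (b ∷ T) =
    cong₂ _+_ (cong (if b then_else 0ℚ) (w≡w′ _)) (sumSub-cong (w≡w′ ∘ Fin.suc) T)

  downClosure : ∀ {m} → List (Subset m) → Subset m → Bool
  downClosure gs U = ⌊ any? (U ⊆?_) gs ⌋

  module _ {m} {gs : List (Subset m)} where

    downClosure⁺ : ∀ {g U} → g ∈ gs → U ⊆ g → downClosure gs U ≡ true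
    downClosure⁺ g∈gs U⊆g = Equivalence.to T-≡ (fromWitness (Any.map (λ { refl {x} → U⊆g {x} }) g∈gs))

    downClosure⁻ : ∀ {U} → downClosure gs U ≡ true → Any (U ⊆_) gs
    downClosure⁻ FU = toWitness (Equivalence.from T-≡ FU)

    downClosure-hereditary : ∀ S U → U ⊆ S → downClosure gs S ≡ true → downClosure gs U ≡ true
    downClosure-hereditary S U U⊆S FS =
      Equivalence.to T-≡ (fromWitness (Any.map (⊆-trans U⊆S) (downClosure⁻ FS)))

  module _ (H : Instance) where
    open Instance H

    private
      admissible : Subset m → Subset m → Bool
      admissible S U = F U ∧ ⌊ U ⊆? S ⌋

      admissible⁺ : ∀ {S U} → F U ≡ true → U ⊆ S → T (admissible S U)
      admissible⁺ FU U⊆S = Equivalence.from T-∧ (Equivalence.from T-≡ FU , fromWitness (λ {x} → U⊆S {x}))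

      admissible⁻ : ∀ {S U} → T (admissible S U) → F U ≡ true × U ⊆ S
      admissible⁻ t with Equivalence.to T-∧ t
      ... | FU , U⊆S = Equivalence.to T-≡ FU , toWitness U⊆S

    valW-feasible : ∀ w {S U} → F U ≡ true → U ⊆ S → sumSub w U ≤ valW H w S
    valW-feasible w {S} {U} FU U⊆S =
      foldr-⊔-upper (sumSub w) _ (∈-filter⁺ (T? ∘ admissible S) (∈-allSubsets U) (admissible⁺ FU U⊆S))

    valW-least : ∀ w {S c} → 0ℚ ≤ c → (∀ U → F U ≡ true → U ⊆ S → sumSub w U ≤ c) → valW H w S ≤ c
    valW-least w {S} 0≤c bound = foldr-⊔-least (sumSub w) _ 0≤c λ U U∈ →
      let FU , U⊆S = admissible⁻ (proj₂ (∈-filter⁻ (T? ∘ admissible S) {xs = allSubsets m} U∈))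
      in bound U FU U⊆S

    valW-cong : ∀ {w w′} → (∀ j → w j ≡ w′ j) → ∀ S → valW H w S ≡ valW H w′ S
    valW-cong w≡w′ S = cong (foldr _⊔_ 0ℚ) (map-cong (sumSub-cong w≡w′) (filterᵇ (admissible S) (allSubsets m)))

    unit-partition-maximin : ∀ {i p} → (∀ k → val H i (part H p k) ≡ 1ℚ) →
                             (∀ p′ → ∃[ k ] (val H i (part H p′ k) ≤ 1ℚ)) →
                             IsMMS H i 1ℚ × MinPart H i p 1ℚ
    unit-partition-maximin {i} {p} unit light = ((p , minPart) , upper) , minPart
      where
      minPart : MinPart H i p 1ℚ
      minPart = (λ k → ≤-reflexive (sym (unit k))) , (proj₁ (light p) , unit (proj₁ (light p)))
      upper : ∀ p′ y → MinPart H i p′ y → y ≤ 1ℚ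
      upper p′ y (y≤ , _) = ≤-trans (y≤ (proj₁ (light p′))) (proj₂ (light p′))

    afterAgents : Subset n → List (Fin n × Subset m) → Subset n
    afterAgents I []            = I
    afterAgents I ((i , _) ∷ L) = afterAgents (I ─ ⁅ i ⁆) L

    afterItems : Subset m → List (Fin n × Subset m) → Subset m
    afterItems J []            = J
    afterItems J ((_ , S) ∷ L) = afterItems (J ─ S) L

    validAllocations : ℕ → Subset n → Subset m → List (Fin n × Subset m) → Bool
    validAllocations τ I J []            = true
    validAllocations τ I J ((i , S) ∷ L) =
      ⌊ i ∈? I ⌋ ∧ ⌊ S ⊆? J ⌋ ∧ ⌊ ∣ S ∣ ℕ.≟ τ ⌋ ∧ validAllocations τ (I ─ ⁅ i ⁆) (J ─ S) L

    module _ (P : Fin n → Partition H) (α : ℚ) where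
      open Procedure H P α

      vhat≡v : ∀ {i} → (∀ k → val H i (part H (P i) k) ≡ 1ℚ) → ∀ j → vhat i j ≡ v i j
      vhat≡v {i} unit j = trans (cong (safeDiv (v i j)) (unit (P i j))) (*-identityʳ (v i j))

      Exec-idle : ∀ {I J} → (∀ i S → i ∈ₛ I → S ⊆ J → valhat i S < α) → ∀ τ → Exec τ I J I
      Exec-idle {I} {J} worthless τ = go (suc m) τ (ℕ.m≤n+m (suc m) τ)
        where
        go : ∀ k τ → m ℕ.< τ ℕ.+ k → Exec τ I J I
        go zero    τ m<τ+0 = finish (subst (m ℕ.<_) (ℕ.+-identityʳ τ) m<τ+0)
        go (suc k) τ m<τ+k with m ℕ.<? τ
        ... | yes m<τ = finish m<τ
        ... | no m≮τ  = next (ℕ.≮⇒≥ m≮τ) (λ i S i∈I S⊆J _ → worthless i S i∈I S⊆J)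
                              (go k (suc τ) (subst (m ℕ.<_) (ℕ.+-suc τ k) m<τ+k))

      Exec-allocations : ∀ {τ I J I′} L → T (validAllocations τ I J L) →
                         All (λ (i , S) → α ≤ valhat i S) L →
                         Exec τ (afterAgents I L) (afterItems J L) I′ → Exec τ I J I′
      Exec-allocations []            _     []                 rest = rest
      Exec-allocations {τ} {I} {J} ((i , S) ∷ L) valid (α≤valhat ∷ worth) rest
        with Equivalence.to (T-∧ {⌊ i ∈? I ⌋}) valid
      ... | i∈I , valid′ with Equivalence.to (T-∧ {⌊ S ⊆? J ⌋}) valid′
      ... | S⊆J , valid″ with Equivalence.to (T-∧ {⌊ ∣ S ∣ ℕ.≟ τ ⌋}) valid″
      ... | ∣S∣≡τ , validL =
        alloc i S (toWitness i∈I) (toWitness S⊆J) (toWitness ∣S∣≡τ) α≤valhat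
          (Exec-allocations L validL worth rest)

module Construction where

  open SubsetSums
  open ScaledRationals
  open Classes
  open HereditaryValues
  open import Defs
  open import Data.Bool using (true; if_then_else_)
  open import Data.Fin using (Fin; toℕ; fromℕ<)
  open import Data.Fin.Properties as FinP using (toℕ-fromℕ<; toℕ<n)
  open import Data.Fin.Subset using (Subset; ⊤)
  open import Data.Fin.Subset.Properties using (⊆-refl)
  open import Data.Integer using (+_)
  open import Data.List using (List; map; _++_; upTo)
  open import Data.List.Membership.Propositional using (_∈_)
  open import Data.List.Membership.Propositional.Properties using (∈-++⁺ˡ; ∈-++⁺ʳ; ∈-map⁺; ∈-upTo⁺)
  open import Data.Nat as ℕ using (ℕ; _+_; _*_; _∸_; _<ᵇ_; _≡ᵇ_)
  import Data.Nat.Properties as ℕ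
  open import Data.Nat.DivMod using (m<n*o⇒m/o<n)
  open import Algebra.Properties.CommutativeMonoid.Sum ℕ.+-0-commutativeMonoid using (sum-syntax)
  open import Data.Product using (_×_; _,_; proj₁; proj₂; ∃-syntax)
  open import Data.Rational using (ℚ; 0ℚ; 1ℚ; _/_; _≤_) renaming (_+_ to _+ℚ_)
  open import Data.Rational.Properties using (≤-trans; ≤-reflexive; ≤-antisym)
  open import Data.Unit using (tt)
  open import Relation.Nullary.Decidable using (toWitness)
  open import Relation.Binary.PropositionalEquality

  agents : ℕ
  agents = 78

  items : ℕ
  items = 858

  -- item x is item number x % 11 of row x / 11
  itemWeight : ℕ → ℕ
  itemWeight x = slot (x ℕ.% 11) (x ℕ./ 11)
    where
    slot : ℕ → ℕ → ℕ
    slot 0 k = 40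
    slot 1 k = if k <ᵇ 36 then 19 else if k <ᵇ 54 then 21 else 20
    slot 2 k = if k <ᵇ 36 then 8 else if k <ᵇ 54 then 6 else 7
    slot _ k = 5

  -- the bundle containing item x, or 77 if there is none
  bundleOf : ℕ → ℕ
  bundleOf x = slot (x ℕ.% 11) (x ℕ./ 11)
    where
    slot : ℕ → ℕ → ℕ
    slot 0 k = k ℕ./ 2
    slot 1 k = if k <ᵇ 36 then 39 + k ℕ./ 2 else if k <ᵇ 54 then 39 + (k ∸ 36) else 57 + (k ∸ 54) ℕ./ 3
    slot 2 k = if k <ᵇ 36 then 65 + k ℕ./ 6 else if k <ᵇ 54 then 71 + (k ∸ 36) ℕ./ 3 else 71 + (k ∸ 54) ℕ./ 4
    slot _ k = 77

  -- agent b receives bundle b, which has bundleSize b items; agent 77 receives nothing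
  bundleSize : ℕ → ℕ
  bundleSize b = if b <ᵇ 39 then 2 else if b <ᵇ 65 then 3 else if b <ᵇ 71 then 6 else if b <ᵇ 77 then 7 else items

  rowOf : Fin items → Fin agents
  rowOf j = fromℕ< (m<n*o⇒m/o<n {toℕ j} {agents} {11} (toℕ<n j))

  -- Opaque, since unification must never unfold these 858-element vectors.
  opaque
    row : ℕ → Subset items
    row k = indicatorFrom items 0 (λ x → x ℕ./ 11 ≡ᵇ k)

    bundle : ℕ → Subset items
    bundle b = indicatorFrom items 0 (λ x → bundleOf x ≡ᵇ b)

    generators : List (Subset items)
    generators = map row (upTo agents) ++ map bundle (upTo 77)

    class-rowOf : ∀ k → class rowOf k ≡ row (toℕ k)
    class-rowOf = class≡indicatorFrom rowOf (ℕ._/ 11) (λ j → toℕ-fromℕ< _)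

    row-weight : ∀ (k : Fin agents) → sumFrom itemWeight 0 (row (toℕ k)) ≡ 107
    row-weight = toWitness {a? = FinP.all? (λ k → sumFrom itemWeight 0 (row (toℕ k)) ℕ.≟ 107)} tt

    row∈generators : ∀ {k} → k ℕ.< agents → row k ∈ generators
    row∈generators k<agents = ∈-++⁺ˡ (∈-map⁺ row (∈-upTo⁺ k<agents))

    bundle∈generators : ∀ {b} → b ℕ.< 77 → bundle b ∈ generators
    bundle∈generators b<77 = ∈-++⁺ʳ (map row (upTo agents)) (∈-map⁺ bundle (∈-upTo⁺ b<77))

  total-weight : sumFrom itemWeight 0 (⊤ {items}) ≡ agents * 107
  total-weight = refl

  -- ⟦ a ⟧ = a / 107, opaque so that unification never unfolds the normalising division
  opaque
    ⟦_⟧ : ℕ → ℚ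
    ⟦ a ⟧ = + a / 107

    ⟦⟧≡/107 : ∀ a → ⟦ a ⟧ ≡ + a / 107
    ⟦⟧≡/107 a = refl

    ⟦107⟧≡1 : ⟦ 107 ⟧ ≡ 1ℚ
    ⟦107⟧≡1 = refl

    ⟦⟧-nonNeg : ∀ a → 0ℚ ≤ ⟦ a ⟧
    ⟦⟧-nonNeg a = +/-nonNeg a 107

    ⟦⟧-mono-≤ : ∀ {a b} → a ℕ.≤ b → ⟦ a ⟧ ≤ ⟦ b ⟧
    ⟦⟧-mono-≤ = /-monoˡ-≤ 107

    ⟦⟧-homo-+ : ∀ a b → ⟦ a + b ⟧ ≡ ⟦ a ⟧ +ℚ ⟦ b ⟧
    ⟦⟧-homo-+ a b = /-homo-+ a b 107

    sumSub-⟦⟧ : ∀ {l} (f : ℕ → ℕ) (T : Subset l) → sumSub (λ j → ⟦ f (toℕ j) ⟧) T ≡ ⟦ sumFrom f 0 T ⟧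
    sumSub-⟦⟧ f = sumSub-/ f 0 107 _ (λ _ → refl)

  weight : Fin items → ℚ
  weight j = ⟦ itemWeight (toℕ j) ⟧

  H : Instance
  H = record
    { n            = agents
    ; m            = items
    ; F            = downClosure generators
    ; F-nonempty   = row 0 , downClosure⁺ (row∈generators ℕ.z<s) ⊆-refl
    ; F-hereditary = downClosure-hereditary
    ; v            = λ _ → weight
    ; v-nonneg     = λ _ j → ⟦⟧-nonNeg (itemWeight (toℕ j))
    }

  val≤weight : ∀ i S → val H i S ≤ ⟦ sumFrom itemWeight 0 S ⟧
  val≤weight i S = valW-least H weight (⟦⟧-nonNeg (sumFrom itemWeight 0 S)) λ U _ U⊆S →
    ≤-trans (≤-reflexive (sumSub-⟦⟧ itemWeight U)) (⟦⟧-mono-≤ (sumFrom-mono itemWeight 0 U⊆S))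

  weight≤val : ∀ i {S} → downClosure generators S ≡ true → ⟦ sumFrom itemWeight 0 S ⟧ ≤ val H i S
  weight≤val i {S} FS = ≤-trans (≤-reflexive (sym (sumSub-⟦⟧ itemWeight S))) (valW-feasible H weight FS ⊆-refl)

  val-row≡1 : ∀ i k → val H i (part H rowOf k) ≡ 1ℚ
  val-row≡1 i k = subst (λ S → val H i S ≡ 1ℚ) (sym (class-rowOf k)) (≤-antisym
    (≤-trans (val≤weight i (row (toℕ k))) (≤-reflexive row-value))
    (≤-trans (≤-reflexive (sym row-value)) (weight≤val i (downClosure⁺ (row∈generators (toℕ<n k)) ⊆-refl))))
    where
    row-value : ⟦ sumFrom itemWeight 0 (row (toℕ k)) ⟧ ≡ 1ℚ
    row-value = trans (cong ⟦_⟧ (row-weight k)) ⟦107⟧≡1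

  some-part-≤1 : ∀ i p → ∃[ k ] (val H i (part H p k) ≤ 1ℚ)
  some-part-≤1 i p = k , ≤-trans (val≤weight i (part H p k)) weight≤1
    where
    total : ∑[ c < agents ] sumFrom itemWeight 0 (part H p c) ≡ agents * 107
    total = trans (∑-sumFrom-class p itemWeight 0) total-weight
    light : ∃[ k ] (sumFrom itemWeight 0 (part H p k) ℕ.≤ 107)
    light = ∑<*⇒∃≤ 107 _ (subst (ℕ._< agents * 108) (sym total) (ℕ.*-monoʳ-< agents (ℕ.n<1+n 107)))
    k : Fin agents
    k = proj₁ light
    weight≤1 : ⟦ sumFrom itemWeight 0 (part H p k) ⟧ ≤ 1ℚ
    weight≤1 = ≤-trans (⟦⟧-mono-≤ (proj₂ light)) (≤-reflexive ⟦107⟧≡1)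

  -- The implicit arguments are given because inferring them would make Agda normalise valW,
  -- which enumerates all subsets of the items.
  rows-maximin : ∀ i → IsMMS H i 1ℚ × MinPart H i rowOf 1ℚ
  rows-maximin i = unit-partition-maximin H {i} {rowOf} (val-row≡1 i) (some-part-≤1 i)

module Phases where

  open SubsetSums
  open Classes
  open HereditaryValues
  open Construction
  open import Data.Bool using (T)
  import Data.Bool as Bool
  open import Data.Bool.Properties using (T?)
  open import Data.Fin using (Fin)
  open import Data.Fin.Subset using (Subset; _∩_)
  open import Data.List using (List; map; filterᵇ; upTo)
  open import Data.List.Relation.Unary.All using (All; all?)
  open import Data.Nat as ℕ using (ℕ; _<ᵇ_; _≡ᵇ_)
  open import Data.Nat.DivMod using (_mod_)
  open import Data.Product using (_×_; _,_)
  open import Data.Unit using (tt)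
  open import Data.Vec.Properties using (≡-dec)
  open import Relation.Nullary using (Dec; _×-dec_)
  open import Relation.Nullary.Decidable using (toWitness)
  open import Relation.Binary.PropositionalEquality using (_≡_)

  agentsAfter : ℕ → Subset agents
  agentsAfter τ = indicatorFrom agents 0 (λ b → τ <ᵇ bundleSize b)

  itemsAfter : ℕ → Subset items
  itemsAfter τ = indicatorFrom items 0 (λ x → τ <ᵇ bundleSize (bundleOf x))

  allocations : ℕ → List (Fin agents × Subset items)
  allocations τ = map (λ b → b mod agents , bundle b) (filterᵇ (λ b → bundleSize b ≡ᵇ τ) (upTo 77))

  PhaseValid : ℕ → Set
  PhaseValid τ =
    T (validAllocations H τ (agentsAfter (ℕ.pred τ)) (itemsAfter (ℕ.pred τ)) (allocations τ)) ×
    afterAgents H (agentsAfter (ℕ.pred τ)) (allocations τ) ≡ agentsAfter τ ×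
    afterItems H (itemsAfter (ℕ.pred τ)) (allocations τ) ≡ itemsAfter τ ×
    All (λ g → T (subsetSumsAtMost τ itemWeight 40 (g ∩ itemsAfter τ))) generators

  phaseValid? : ∀ τ → Dec (PhaseValid τ)
  phaseValid? τ =
    T? _ ×-dec ≡-dec Bool._≟_ _ _ ×-dec ≡-dec Bool._≟_ _ _ ×-dec
    all? (λ g → T? (subsetSumsAtMost τ itemWeight 40 (g ∩ itemsAfter τ))) generators

  opaque
    unfolding row bundle generators

    phase1-valid : PhaseValid 1
    phase1-valid = toWitness {a? = phaseValid? 1} tt

    phase2-valid : PhaseValid 2
    phase2-valid = toWitness {a? = phaseValid? 2} tt

    phase3-valid : PhaseValid 3
    phase3-valid = toWitness {a? = phaseValid? 3} tt

    phase4-valid : PhaseValid 4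
    phase4-valid = toWitness {a? = phaseValid? 4} tt

    phase5-valid : PhaseValid 5
    phase5-valid = toWitness {a? = phaseValid? 5} tt

    phase6-valid : PhaseValid 6
    phase6-valid = toWitness {a? = phaseValid? 6} tt

    phase7-valid : PhaseValid 7
    phase7-valid = toWitness {a? = phaseValid? 7} tt

    leftovers-light : All (λ g → sumFrom itemWeight 0 (g ∩ itemsAfter 7) ℕ.≤ 40) generators
    leftovers-light = toWitness {a? = all? (λ g → sumFrom itemWeight 0 (g ∩ itemsAfter 7) ℕ.≤? 40) generators} tt

    bundle-weight : All (λ b → 46 ℕ.≤ sumFrom itemWeight 0 (bundle b)) (upTo 77)
    bundle-weight = toWitness {a? = all? (λ b → 46 ℕ.≤? sumFrom itemWeight 0 (bundle b)) (upTo 77)} tt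

open SubsetSums
open HereditaryValues
open Construction
open Phases
open import Defs
open import Data.Bool using (true)
open import Data.Bool.Properties using (T?)
open import Data.Fin using (fromℕ)
open import Data.Fin.Subset using (_⊆_; ∣_∣; ⊤) renaming (_∈_ to _∈ₛ_)
open import Data.Fin.Subset.Properties using (⊆-refl; p⊆q⇒∣p∣≤∣q∣; x∈p∩q⁺; _∈?_)
open import Data.Integer using (+_)
open import Data.List.Membership.Propositional.Properties using (∈-upTo⁺)
import Data.List.Relation.Unary.All as All
open import Data.List.Relation.Unary.All.Properties using (map⁺; filter⁺; applyUpTo⁺₁)
open import Data.Nat as ℕ using (suc)
open import Data.Nat.DivMod using (_mod_)
import Data.Nat.Properties as ℕ
open import Data.Product using (_×_; _,_; proj₁; ∃-syntax)
open import Data.Rational using (ℚ; 0ℚ; 1ℚ; _+_; _/_; _≤_; _<_; _<?_)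
open import Data.Rational.Properties using (≤-trans; ≤-reflexive; <⇒≤; +-monoʳ-<; +-identityʳ; module ≤-Reasoning)
open import Data.Unit using (tt)
open import Function using (_∘_; id)
open import Relation.Nullary.Decidable using (True; toWitness)
open import Relation.Binary.PropositionalEquality

module Execution (ε : ℚ) (0<ε : 0ℚ < ε) (ε<6/107 : ε < + 6 / 107) where

  α : ℚ
  α = + 40 / 107 + ε

  open Procedure H (λ _ → rowOf) α

  valhat≡val : ∀ i S → valhat i S ≡ val H i S
  valhat≡val i S = valW-cong H {vhat i} {weight} (vhat≡v H (λ _ → rowOf) α {i} (val-row≡1 i)) S

  40<α : ⟦ 40 ⟧ < α
  40<α = begin-strict
    ⟦ 40 ⟧           ≡⟨ ⟦⟧≡/107 40 ⟩
    + 40 / 107       ≡⟨ +-identityʳ _ ⟨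
    + 40 / 107 + 0ℚ  <⟨ +-monoʳ-< _ 0<ε ⟩
    α                ∎
    where open ≤-Reasoning

  α<46 : α < ⟦ 46 ⟧
  α<46 = begin-strict
    α                       <⟨ +-monoʳ-< _ ε<6/107 ⟩
    + 40 / 107 + + 6 / 107  ≡⟨ cong₂ _+_ (⟦⟧≡/107 40) (⟦⟧≡/107 6) ⟨
    ⟦ 40 ⟧ + ⟦ 6 ⟧          ≡⟨ ⟦⟧-homo-+ 40 6 ⟨
    ⟦ 46 ⟧                  ∎
    where open ≤-Reasoning

  valhat<α : ∀ i S → (∀ U → downClosure generators U ≡ true → U ⊆ S → sumFrom itemWeight 0 U ℕ.≤ 40) →
             valhat i S < α
  valhat<α i S light = begin-strict
    valhat i S  ≡⟨ valhat≡val i S ⟩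
    val H i S   ≤⟨ valW-least H weight (⟦⟧-nonNeg 40) (λ U FU U⊆S →
                     ≤-trans (≤-reflexive (sumSub-⟦⟧ itemWeight U)) (⟦⟧-mono-≤ (light U FU U⊆S))) ⟩
    ⟦ 40 ⟧      <⟨ 40<α ⟩
    α           ∎
    where open ≤-Reasoning

  α≤valhat-bundle : ∀ i {b} → b ℕ.< 77 → α ≤ valhat i (bundle b)
  α≤valhat-bundle i {b} b<77 = begin
    α                                    ≤⟨ <⇒≤ α<46 ⟩
    ⟦ 46 ⟧                               ≤⟨ ⟦⟧-mono-≤ (All.lookup bundle-weight (∈-upTo⁺ b<77)) ⟩
    ⟦ sumFrom itemWeight 0 (bundle b) ⟧  ≤⟨ weight≤val i (downClosure⁺ (bundle∈generators b<77) ⊆-refl) ⟩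
    val H i (bundle b)                   ≡⟨ valhat≡val i _ ⟨
    valhat i (bundle b)                  ∎
    where open ≤-Reasoning

  phase : ∀ τ {τ≤items : True (τ ℕ.≤? items)} {I′} → PhaseValid τ →
          Exec (suc τ) (agentsAfter τ) (itemsAfter τ) I′ →
          Exec τ (agentsAfter (ℕ.pred τ)) (itemsAfter (ℕ.pred τ)) I′
  phase τ {τ≤items} (valid , agents≡ , items≡ , small) rest =
    Exec-allocations H (λ _ → rowOf) α (allocations τ) valid
      (map⁺ (filter⁺ (T? ∘ λ b → bundleSize b ℕ.≡ᵇ τ) (applyUpTo⁺₁ id 77 λ {b} → α≤valhat-bundle (b mod agents))))
      (subst₂ (λ I J → Exec τ I J _) (sym agents≡) (sym items≡)
        (next (toWitness τ≤items) (λ i S _ S⊆J ∣S∣≡τ → valhat<α i S (light S⊆J ∣S∣≡τ)) rest))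
    where
    light : ∀ {S} → S ⊆ itemsAfter τ → ∣ S ∣ ≡ τ →
            ∀ U → downClosure generators U ≡ true → U ⊆ S → sumFrom itemWeight 0 U ℕ.≤ 40
    light S⊆J ∣S∣≡τ U FU U⊆S with All.lookupAny small (downClosure⁻ FU)
    ... | test , U⊆g = subsetSumsAtMost-sound τ itemWeight 40 test
                         (λ x∈U → x∈p∩q⁺ (U⊆g x∈U , S⊆J (U⊆S x∈U)))
                         (subst (∣ U ∣ ℕ.≤_) ∣S∣≡τ (p⊆q⇒∣p∣≤∣q∣ U⊆S))

  leftovers-worthless : ∀ i S → i ∈ₛ agentsAfter 7 → S ⊆ itemsAfter 7 → valhat i S < α
  leftovers-worthless i S _ S⊆J = valhat<α i S light
    where
    light : ∀ U → downClosure generators U ≡ true → U ⊆ S → sumFrom itemWeight 0 U ℕ.≤ 40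
    light U FU U⊆S with All.lookupAny leftovers-light (downClosure⁻ FU)
    ... | g-light , U⊆g =
      ℕ.≤-trans (sumFrom-mono itemWeight 0 (λ x∈U → x∈p∩q⁺ (U⊆g x∈U , S⊆J (U⊆S x∈U)))) g-light

  execution : Exec 1 ⊤ ⊤ (agentsAfter 7)
  execution =
    phase 1 phase1-valid (phase 2 phase2-valid (phase 3 phase3-valid (phase 4 phase4-valid
      (phase 5 phase5-valid (phase 6 phase6-valid (phase 7 phase7-valid
        (Exec-idle H (λ _ → rowOf) α leftovers-worthless 8)))))))

  last-agent-unallocated : SomeAgentUnallocated
  last-agent-unallocated = agentsAfter 7 , execution , fromℕ 77 , toWitness {a? = fromℕ 77 ∈? agentsAfter 7} tt

theorem4 : ∃[ ε₀ ] (0ℚ < ε₀ × (∀ (ε : ℚ) → 0ℚ < ε → ε < ε₀ →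
             ∃[ H ] ((∀ i → IsMMS H i 1ℚ) ×
               ∃[ P ] ((∀ i → IsMaximinPartition H i (P i)) ×
                 Procedure.SomeAgentUnallocated H P ((+ 40 / 107) + ε)))))
theorem4 = + 6 / 107 , toWitness {a? = 0ℚ <? + 6 / 107} tt , λ ε 0<ε ε<6/107 →
  H , proj₁ ∘ rows-maximin , (λ _ → rowOf) , (λ i → 1ℚ , rows-maximin i) ,
  Execution.last-agent-unallocated ε 0<ε ε<6/107
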